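{- The following hold for monitors in $Mon_F$: (i) $\simeq$ and $\simeq_\omega$ are both congruences (equivalence relations preserved by $a.\_$ for every $a\in Act$ and by $+$); (ii) $\simeq\,\subseteq\,\simeq_\omega$, and the inclusion is strict when $Act$ is finite; (iii) if $Act$ is infinite then $\simeq\,=\,\simeq_\omega$.
   Context: Fix a set $Act$ of visible actions, a symbol $\tau\notin Act$, and a countably infinite set $Var$ of variables disjoint from $Act\cup\{\tau\}$. Monitors $Mon_F$: $m,n ::= v \mid a.m \mid m+n \mid x$ ($a\in Act$, $x\in Var$), verdicts $v ::= \mathit{end}\mid \mathit{yes}\mid \mathit{no}$. Closed monitors contain no variables; closed substitutions map variables to closed monitors. Transitions: for $\alpha\in Act\cup\{\tau\}$, $\xrightarrow{\alpha}$ is the least relation with $a.m\xrightarrow{a}m$; if $m\xrightarrow{\alpha}m'$ then $m+n\xrightarrow{\alpha}m'$ and $n+m\xrightarrow{\alpha}m'$; and $v\xrightarrow{\alpha}v$ for every verdict $v$ and every $\alpha$. Weak transitions: $m\xRightarrow{\varepsilon}m'$ iff $m(\xrightarrow{\tau})^*m'$; $m\xRightarrow{a}m'$ iff $m\xRightarrow{\varepsilon}m_1\xrightarrow{a}m_2\xRightarrow{\varepsilon}m'$; $m\xRightarrow{as'}m'$ ($s'\neq\varepsilon$) iff $m\xRightarrow{a}m_1\xRightarrow{s'}m'$. $L_a(m)=\{s\in Act^*\mid m\xRightarrow{s}\mathit{yes}\}$, $L_r(m)=\{s\in Act^*\mid m\xRightarrow{s}\mathit{no}\}$. For closed $m,n$: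 $m\simeq n$ iff $L_a(m)=L_a(n)$ and $L_r(m)=L_r(n)$; $m\simeq_\omega n$ iff $L_a(m)\cdot Act^\omega=L_a(n)\cdot Act^\omega$ and $L_r(m)\cdot Act^\omega=L_r(n)\cdot Act^\omega$. For open $m,n$, $m\simeq n$ (resp. $m\simeq_\omega n$) iff $\sigma(m)\simeq\sigma(n)$ (resp. $\sigma(m)\simeq_\omega\sigma(n)$) for all closed substitutions $\sigma$. -}

module Defs where

open import Data.Nat using (ℕ; zero; suc)
open import Data.List using (List; []; _∷_)
open import Data.List.Membership.Propositional using (_∈_; _∉_)
open import Data.Product using (Σ; ∃; ∃₂; _×_; _,_)
open import Relation.Binary.PropositionalEquality using (_≡_)
open import Relation.Binary.Structures using (IsEquivalence)
open import Relation.Binary.Core using (Rel)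
import Agda.Primitive

data Verdict : Set where
  end yes no : Verdict

data Mon (Act : Set) : Set where
  verd : Verdict → Mon Act
  act  : Act → Mon Act → Mon Act
  _⊕_  : Mon Act → Mon Act → Mon Act
  var  : ℕ → Mon Act

infixr 6 _⊕_

data Lbl (Act : Set) : Set where
  τ   : Lbl Act
  vis : Act → Lbl Act

data _—[_]→_ {Act : Set} : Mon Act → Lbl Act → Mon Act → Set where
  actS  : ∀ {a m} → act a m —[ vis a ]→ m
  sumL  : ∀ {α m m′ n} → m —[ α ]→ m′ → (m ⊕ n) —[ α ]→ m′
  sumR  : ∀ {α m m′ n} → m —[ α ]→ m′ → (n ⊕ m) —[ α ]→ m′
  verdS : ∀ {α v} → verd v —[ α ]→ verd v

data _⇒ε_ {Act : Set} : Mon Act → Mon Act → Set where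
  ε-refl : ∀ {m} → m ⇒ε m
  ε-step : ∀ {m m₁ m′} → m —[ τ ]→ m₁ → m₁ ⇒ε m′ → m ⇒ε m′

_⇒[_]_ : {Act : Set} → Mon Act → Act → Mon Act → Set
m ⇒[ a ] m′ = ∃₂ λ m₁ m₂ → (m ⇒ε m₁) × (m₁ —[ vis a ]→ m₂) × (m₂ ⇒ε m′)

data _=[_]⇒_ {Act : Set} : Mon Act → List Act → Mon Act → Set where
  w-ε    : ∀ {m m′} → m ⇒ε m′ → m =[ [] ]⇒ m′
  w-one  : ∀ {a m m′} → m ⇒[ a ] m′ → m =[ a ∷ [] ]⇒ m′
  w-cons : ∀ {a b s m m₁ m′} → m ⇒[ a ] m₁ → m₁ =[ b ∷ s ]⇒ m′ → m =[ a ∷ b ∷ s ]⇒ m′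

Lₐ : {Act : Set} → Mon Act → List Act → Set
Lₐ m s = m =[ s ]⇒ verd yes

Lᵣ : {Act : Set} → Mon Act → List Act → Set
Lᵣ m s = m =[ s ]⇒ verd no

Stream : Set → Set
Stream Act = ℕ → Act

_⋯_ : {Act : Set} → List Act → Stream Act → Stream Act
([] ⋯ u) i = u i
((a ∷ s) ⋯ u) zero = a
((a ∷ s) ⋯ u) (suc i) = (s ⋯ u) i

_·ω : {Act : Set} → (List Act → Set) → Stream Act → Set
(L ·ω) w = ∃₂ λ s u → L s × (∀ i → w i ≡ (s ⋯ u) i)

_≐_ : {X : Set} → (X → Set) → (X → Set) → Set
P ≐ Q = ∀ x → (P x → Q x) × (Q x → P x)

data Closed {Act : Set} : Mon Act → Set where
  c-verd : ∀ {v} → Closed (verd v)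
  c-act  : ∀ {a m} → Closed m → Closed (act a m)
  c-sum  : ∀ {m n} → Closed m → Closed n → Closed (m ⊕ n)

ClosedSubst : {Act : Set} → (ℕ → Mon Act) → Set
ClosedSubst σ = ∀ x → Closed (σ x)

subst : {Act : Set} → (ℕ → Mon Act) → Mon Act → Mon Act
subst σ (verd v) = verd v
subst σ (act a m) = act a (subst σ m)
subst σ (m ⊕ n) = subst σ m ⊕ subst σ n
subst σ (var x) = σ x

_≃c_ : {Act : Set} → Mon Act → Mon Act → Set
m ≃c n = (Lₐ m ≐ Lₐ n) × (Lᵣ m ≐ Lᵣ n)

_≃ωc_ : {Act : Set} → Mon Act → Mon Act → Set
m ≃ωc n = ((Lₐ m ·ω) ≐ (Lₐ n ·ω)) × ((Lᵣ m ·ω) ≐ (Lᵣ n ·ω))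

-- Equivalences on arbitrary (possibly open) monitors, via all closed substitutions
-- (for closed m, n, subst σ m = m, so this agrees with ≃c / ≃ωc)
_≃_ : {Act : Set} → Mon Act → Mon Act → Set
m ≃ n = ∀ σ → ClosedSubst σ → subst σ m ≃c subst σ n

_≃ω_ : {Act : Set} → Mon Act → Mon Act → Set
m ≃ω n = ∀ σ → ClosedSubst σ → subst σ m ≃ωc subst σ n

record IsCongruence {Act : Set} (R : Rel (Mon Act) Agda.Primitive.lzero) : Set₁ where
  field
    isEquivalence : IsEquivalence R
    pres-act : ∀ a {m n} → R m n → R (act a m) (act a n)
    pres-sum : ∀ {m m′ n n′} → R m m′ → R n n′ → R (m ⊕ n) (m′ ⊕ n′)

Finite : Set → Set
Finite A = ∃ λ (xs : List A) → ∀ a → a ∈ xs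

Infinite : Set → Set
Infinite A = ∀ (xs : List A) → ∃ λ a → a ∉ xs

-- The languages are compositional, L(a.m) = a·L(m) and L(m + n) = L(m) ∪ L(n),
-- and both operations commute with _·Act^ω; since substitution commutes with the
-- monitor constructors, both equivalences are congruences on open monitors too.
-- For finite Act, yes and Σ_{a∈Act} a.yes are ω-equivalent (every infinite word
-- has an accepted prefix of length ≤ 1) but only yes accepts the empty trace.
-- For infinite Act, given s ∈ L(m), pad s with an action a that n never mentions:
-- an accepted prefix of s·a^ω in L(n) cannot get beyond s, except through a
-- verdict, which accepts s already.
module Submission where

open import Defs
open import Level using (0ℓ)
open import Data.Empty using (⊥-elim)
open import Data.Nat using (zero; suc)
open import Data.List using (List; []; _∷_; _++_)
open import Data.List.Membership.Propositional using (_∈_; _∉_)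
open import Data.List.Membership.Propositional.Properties using (∈-++⁺ˡ; ∈-++⁺ʳ)
open import Data.List.Relation.Unary.Any using (here; there)
open import Data.Product using (_×_; ∃; ∃₂; _,_; proj₁; proj₂)
open import Data.Product.Relation.Binary.Pointwise.NonDependent using (×-isEquivalence)
open import Data.Sum using (_⊎_; inj₁; inj₂)
import Data.Sum as Sum
open import Function using (id; const)
open import Relation.Nullary using (¬_)
open import Relation.Unary using (Pred; _∪_; _⊆_)
open import Relation.Binary.Core using (Rel)
open import Relation.Binary.Bundles using (Setoid)
open import Relation.Binary.Structures using (IsEquivalence)
import Relation.Binary.Construct.On as On
import Relation.Binary.Reasoning.Setoid as SetoidReasoning
open import Relation.Binary.PropositionalEquality using (_≡_; refl; sym; cong; cong₂)

module _ {X : Set} where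

  ≐-sym : {P Q : Pred X 0ℓ} → P ≐ Q → Q ≐ P
  ≐-sym e x = proj₂ (e x) , proj₁ (e x)

  ≐-trans : {P Q R : Pred X 0ℓ} → P ≐ Q → Q ≐ R → P ≐ R
  ≐-trans e f x = (λ p → proj₁ (f x) (proj₁ (e x) p)) , (λ r → proj₂ (e x) (proj₂ (f x) r))

  ≐-isEquivalence : IsEquivalence (_≐_ {X})
  ≐-isEquivalence = record { refl = λ x → id , id ; sym = ≐-sym ; trans = ≐-trans }

  ≐⇒⊆ : {P Q : Pred X 0ℓ} → P ≐ Q → P ⊆ Q
  ≐⇒⊆ e {x} = proj₁ (e x)

  ⊆-antisym : {P Q : Pred X 0ℓ} → P ⊆ Q → Q ⊆ P → P ≐ Q
  ⊆-antisym P⊆Q Q⊆P x = P⊆Q , Q⊆P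

  ∪-resp-≐ : {P P′ Q Q′ : Pred X 0ℓ} → P ≐ P′ → Q ≐ Q′ → (P ∪ Q) ≐ (P′ ∪ Q′)
  ∪-resp-≐ e f x = Sum.map (proj₁ (e x)) (proj₁ (f x)) , Sum.map (proj₂ (e x)) (proj₂ (f x))

≐-setoid : Set → Setoid _ _
≐-setoid X = record { isEquivalence = ≐-isEquivalence {X} }

module _ {Act : Set} where

  _◃_ : Act → Pred (List Act) 0ℓ → Pred (List Act) 0ℓ
  (a ◃ P) s = ∃ λ t → s ≡ a ∷ t × P t

  _◃ω_ : Act → Pred (Stream Act) 0ℓ → Pred (Stream Act) 0ℓ
  (a ◃ω W) w = w 0 ≡ a × W (λ i → w (suc i))

  module _ {P Q : Pred (List Act) 0ℓ} where

    ◃-resp-≐ : ∀ {a} → P ≐ Q → (a ◃ P) ≐ (a ◃ Q)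
    ◃-resp-≐ e s = (λ (t , eq , p) → t , eq , proj₁ (e t) p)
                 , (λ (t , eq , q) → t , eq , proj₂ (e t) q)

    ·ω-resp-≐ : P ≐ Q → (P ·ω) ≐ (Q ·ω)
    ·ω-resp-≐ e w = (λ (s , u , p , eq) → s , u , proj₁ (e s) p , eq)
                  , (λ (s , u , q , eq) → s , u , proj₂ (e s) q , eq)

    ·ω-∪ : ((P ∪ Q) ·ω) ≐ ((P ·ω) ∪ (Q ·ω))
    ·ω-∪ w = (λ { (s , u , inj₁ p , eq) → inj₁ (s , u , p , eq)
                ; (s , u , inj₂ q , eq) → inj₂ (s , u , q , eq) })
           , (λ { (inj₁ (s , u , p , eq)) → s , u , inj₁ p , eq
                ; (inj₂ (s , u , q , eq)) → s , u , inj₂ q , eq })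

  ◃ω-resp-≐ : ∀ {a} {V W : Pred (Stream Act) 0ℓ} → V ≐ W → (a ◃ω V) ≐ (a ◃ω W)
  ◃ω-resp-≐ e w = (λ (h , v) → h , proj₁ (e _) v) , (λ (h , v) → h , proj₂ (e _) v)

  ·ω-◃ : ∀ {a} {P : Pred (List Act) 0ℓ} → ((a ◃ P) ·ω) ≐ (a ◃ω (P ·ω))
  ·ω-◃ {a} w = (λ { (_ , u , (t , refl , p) , eq) → eq zero , t , u , p , (λ i → eq (suc i)) })
             , (λ (w₀≡a , t , u , p , eq) →
                  a ∷ t , u , (t , refl , p) , λ { zero → w₀≡a ; (suc i) → eq i })

  ·ω-full : {P : Pred (List Act) 0ℓ} → (∀ a → P (a ∷ [])) → ∀ w → (P ·ω) w
  ·ω-full h w = w 0 ∷ [] , (λ i → w (suc i)) , h (w 0) , λ { zero → refl ; (suc i) → refl }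

  Lang : Verdict → Mon Act → Pred (List Act) 0ℓ
  Lang v m s = m =[ s ]⇒ verd v

  -- stop absorbs the rest of the trace, since verdicts loop on every action.
  data Reaches (v : Verdict) : Mon Act → List Act → Set where
    stop     : ∀ {s} → Reaches v (verd v) s
    τ-step   : ∀ {m m′ s} → m —[ τ ]→ m′ → Reaches v m′ s → Reaches v m s
    vis-step : ∀ {m m′ a s} → m —[ vis a ]→ m′ → Reaches v m′ s → Reaches v m (a ∷ s)

  module _ {v : Verdict} where

    ⇒ε-Reaches : ∀ {m m′ s} → m ⇒ε m′ → Reaches v m′ s → Reaches v m s
    ⇒ε-Reaches ε-refl        r = r
    ⇒ε-Reaches (ε-step st e) r = τ-step st (⇒ε-Reaches e r)

    weak⇒Reaches : ∀ {m s} → m =[ s ]⇒ verd v → Reaches v m s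
    weak⇒Reaches (w-ε e) = ⇒ε-Reaches e stop
    weak⇒Reaches (w-one (_ , _ , e₁ , st , e₂)) =
      ⇒ε-Reaches e₁ (vis-step st (⇒ε-Reaches e₂ stop))
    weak⇒Reaches (w-cons (_ , _ , e₁ , st , e₂) r) =
      ⇒ε-Reaches e₁ (vis-step st (⇒ε-Reaches e₂ (weak⇒Reaches r)))

    verd-weak : ∀ (s : List Act) → verd v =[ s ]⇒ verd v
    verd-weak []          = w-ε ε-refl
    verd-weak (a ∷ [])    = w-one (_ , _ , ε-refl , verdS , ε-refl)
    verd-weak (a ∷ b ∷ s) = w-cons (_ , _ , ε-refl , verdS , ε-refl) (verd-weak (b ∷ s))

  τ-weak : ∀ {m m′ n : Mon Act} {s} → m —[ τ ]→ m′ → m′ =[ s ]⇒ n → m =[ s ]⇒ n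
  τ-weak st (w-ε e)                          = w-ε (ε-step st e)
  τ-weak st (w-one (_ , _ , e₁ , t , e₂))    = w-one (_ , _ , ε-step st e₁ , t , e₂)
  τ-weak st (w-cons (_ , _ , e₁ , t , e₂) r) = w-cons (_ , _ , ε-step st e₁ , t , e₂) r

  vis-weak : ∀ {m m′ n : Mon Act} {a s} → m —[ vis a ]→ m′ → m′ =[ s ]⇒ n → m =[ a ∷ s ]⇒ n
  vis-weak st (w-ε e)      = w-one (_ , _ , ε-refl , st , e)
  vis-weak st (w-one h)    = w-cons (_ , _ , ε-refl , st , ε-refl) (w-one h)
  vis-weak st (w-cons h r) = w-cons (_ , _ , ε-refl , st , ε-refl) (w-cons h r)

  Reaches⇒weak : ∀ {v m} {s : List Act} → Reaches v m s → m =[ s ]⇒ verd v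
  Reaches⇒weak {s = s} stop    = verd-weak s
  Reaches⇒weak (τ-step st r)   = τ-weak st (Reaches⇒weak r)
  Reaches⇒weak (vis-step st r) = vis-weak st (Reaches⇒weak r)

  Lang≐Reaches : ∀ {v m} → Lang v m ≐ Reaches v m
  Lang≐Reaches s = weak⇒Reaches , Reaches⇒weak

  Reaches-verd : ∀ {v v′ s} → Reaches v (verd v′) s → v′ ≡ v
  Reaches-verd stop              = refl
  Reaches-verd (τ-step verdS r)   = Reaches-verd r
  Reaches-verd (vis-step verdS r) = Reaches-verd r

  Reaches-act : ∀ {v a m} → Reaches v (act a m) ≐ (a ◃ Reaches v m)
  Reaches-act s = (λ { (vis-step actS r) → _ , refl , r })
                , (λ { (_ , refl , r) → vis-step actS r })

  Reaches-⊕ : ∀ {v m n} → Reaches v (m ⊕ n) ≐ (Reaches v m ∪ Reaches v n)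
  Reaches-⊕ s = split , Sum.[ inl , inr ]
    where
    split : ∀ {v m n s} → Reaches v (m ⊕ n) s → (Reaches v m ∪ Reaches v n) s
    split (τ-step (sumL st) r)   = inj₁ (τ-step st r)
    split (τ-step (sumR st) r)   = inj₂ (τ-step st r)
    split (vis-step (sumL st) r) = inj₁ (vis-step st r)
    split (vis-step (sumR st) r) = inj₂ (vis-step st r)

    inl : ∀ {v m n s} → Reaches v m s → Reaches v (m ⊕ n) s
    inl stop            = τ-step (sumL verdS) stop
    inl (τ-step st r)   = τ-step (sumL st) r
    inl (vis-step st r) = vis-step (sumL st) r

    inr : ∀ {v m n s} → Reaches v n s → Reaches v (m ⊕ n) s
    inr stop            = τ-step (sumR verdS) stop
    inr (τ-step st r)   = τ-step (sumR st) r
    inr (vis-step st r) = vis-step (sumR st) r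

  module _ {v : Verdict} {a : Act} {m : Mon Act} where
    open SetoidReasoning (≐-setoid (List Act))

    Lang-act : Lang v (act a m) ≐ (a ◃ Lang v m)
    Lang-act = begin
      Lang v (act a m)   ≈⟨ Lang≐Reaches ⟩
      Reaches v (act a m) ≈⟨ Reaches-act ⟩
      a ◃ Reaches v m    ≈⟨ ◃-resp-≐ Lang≐Reaches ⟨
      a ◃ Lang v m       ∎

  module _ {v : Verdict} {m n : Mon Act} where
    open SetoidReasoning (≐-setoid (List Act))

    Lang-⊕ : Lang v (m ⊕ n) ≐ (Lang v m ∪ Lang v n)
    Lang-⊕ = begin
      Lang v (m ⊕ n)                ≈⟨ Lang≐Reaches ⟩
      Reaches v (m ⊕ n)             ≈⟨ Reaches-⊕ ⟩
      Reaches v m ∪ Reaches v n     ≈⟨ ∪-resp-≐ Lang≐Reaches Lang≐Reaches ⟨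
      Lang v m ∪ Lang v n           ∎

  module _ {v : Verdict} {m n : Mon Act} where

    Lang-act-resp : ∀ {a} → Lang v m ≐ Lang v n → Lang v (act a m) ≐ Lang v (act a n)
    Lang-act-resp e = ≐-trans Lang-act (≐-trans (◃-resp-≐ e) (≐-sym Lang-act))

    Langω-act-resp : ∀ {a} → (Lang v m ·ω) ≐ (Lang v n ·ω)
                   → (Lang v (act a m) ·ω) ≐ (Lang v (act a n) ·ω)
    Langω-act-resp {a} e = begin
      Lang v (act a m) ·ω  ≈⟨ ·ω-resp-≐ Lang-act ⟩
      (a ◃ Lang v m) ·ω    ≈⟨ ·ω-◃ ⟩
      a ◃ω (Lang v m ·ω)   ≈⟨ ◃ω-resp-≐ e ⟩
      a ◃ω (Lang v n ·ω)   ≈⟨ ·ω-◃ ⟨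
      (a ◃ Lang v n) ·ω    ≈⟨ ·ω-resp-≐ Lang-act ⟨
      Lang v (act a n) ·ω  ∎
      where open SetoidReasoning (≐-setoid (Stream Act))

  module _ {v : Verdict} {m m′ n n′ : Mon Act} where

    Lang-⊕-resp : Lang v m ≐ Lang v m′ → Lang v n ≐ Lang v n′
                → Lang v (m ⊕ n) ≐ Lang v (m′ ⊕ n′)
    Lang-⊕-resp e f = ≐-trans Lang-⊕ (≐-trans (∪-resp-≐ e f) (≐-sym Lang-⊕))

    Langω-⊕-resp : (Lang v m ·ω) ≐ (Lang v m′ ·ω) → (Lang v n ·ω) ≐ (Lang v n′ ·ω)
                 → (Lang v (m ⊕ n) ·ω) ≐ (Lang v (m′ ⊕ n′) ·ω)
    Langω-⊕-resp e f = begin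
      Lang v (m ⊕ n) ·ω                 ≈⟨ ·ω-resp-≐ Lang-⊕ ⟩
      (Lang v m ∪ Lang v n) ·ω          ≈⟨ ·ω-∪ ⟩
      (Lang v m ·ω) ∪ (Lang v n ·ω)     ≈⟨ ∪-resp-≐ e f ⟩
      (Lang v m′ ·ω) ∪ (Lang v n′ ·ω)   ≈⟨ ·ω-∪ ⟨
      (Lang v m′ ∪ Lang v n′) ·ω        ≈⟨ ·ω-resp-≐ Lang-⊕ ⟨
      Lang v (m′ ⊕ n′) ·ω               ∎
      where open SetoidReasoning (≐-setoid (Stream Act))

  ≃c-isCongruence : IsCongruence (_≃c_ {Act})
  ≃c-isCongruence = record
    { isEquivalence = On.isEquivalence (λ m → Lₐ m , Lᵣ m)
                        (×-isEquivalence ≐-isEquivalence ≐-isEquivalence)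
    ; pres-act = λ a (eₐ , eᵣ) → Lang-act-resp eₐ , Lang-act-resp eᵣ
    ; pres-sum = λ (eₐ , eᵣ) (fₐ , fᵣ) → Lang-⊕-resp eₐ fₐ , Lang-⊕-resp eᵣ fᵣ
    }

  ≃ωc-isCongruence : IsCongruence (_≃ωc_ {Act})
  ≃ωc-isCongruence = record
    { isEquivalence = On.isEquivalence (λ m → (Lₐ m ·ω) , (Lᵣ m ·ω))
                        (×-isEquivalence ≐-isEquivalence ≐-isEquivalence)
    ; pres-act = λ a (eₐ , eᵣ) → Langω-act-resp eₐ , Langω-act-resp eᵣ
    ; pres-sum = λ (eₐ , eᵣ) (fₐ , fᵣ) → Langω-⊕-resp eₐ fₐ , Langω-⊕-resp eᵣ fᵣ
    }

  ≃c⇒≃ωc : ∀ {m n : Mon Act} → m ≃c n → m ≃ωc n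
  ≃c⇒≃ωc (eₐ , eᵣ) = ·ω-resp-≐ eₐ , ·ω-resp-≐ eᵣ

  acts : Mon Act → List Act
  acts (verd v)  = []
  acts (act a m) = a ∷ acts m
  acts (m ⊕ n)   = acts m ++ acts n
  acts (var x)   = []

  acts-step : ∀ {m α m′ b} → m —[ α ]→ m′ → b ∈ acts m′ → b ∈ acts m
  acts-step actS              b∈ = there b∈
  acts-step (sumL st)         b∈ = ∈-++⁺ˡ (acts-step st b∈)
  acts-step (sumR {n = n} st) b∈ = ∈-++⁺ʳ (acts n) (acts-step st b∈)

  vis-step-acts⊎verdict : ∀ {m b m′} → m —[ vis b ]→ m′
                        → b ∈ acts m ⊎ (m —[ τ ]→ m′ × ∃ λ v → m′ ≡ verd v)
  vis-step-acts⊎verdict actS = inj₁ (here refl)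
  vis-step-acts⊎verdict (sumL st) with vis-step-acts⊎verdict st
  ... | inj₁ b∈             = inj₁ (∈-++⁺ˡ b∈)
  ... | inj₂ (st′ , verdict) = inj₂ (sumL st′ , verdict)
  vis-step-acts⊎verdict (sumR {n = n} st) with vis-step-acts⊎verdict st
  ... | inj₁ b∈             = inj₁ (∈-++⁺ʳ (acts n) b∈)
  ... | inj₂ (st′ , verdict) = inj₂ (sumR st′ , verdict)
  vis-step-acts⊎verdict verdS = inj₂ (verdS , _ , refl)

  Reaches-fresh-prefix : ∀ {v m} {a : Act} {t u} s → a ∉ acts m → Reaches v m t
                       → (∀ i → (t ⋯ u) i ≡ (s ⋯ const a) i) → Reaches v m s
  Reaches-fresh-prefix s a∉ stop eq = stop
  Reaches-fresh-prefix s a∉ (τ-step st r) eq =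
    τ-step st (Reaches-fresh-prefix s (λ a∈ → a∉ (acts-step st a∈)) r eq)
  Reaches-fresh-prefix s a∉ (vis-step st r) eq with vis-step-acts⊎verdict st
  ... | inj₂ (st′ , _ , refl) with Reaches-verd r
  ...   | refl = τ-step st′ stop
  Reaches-fresh-prefix [] a∉ (vis-step st r) eq | inj₁ b∈ with eq zero
  ... | refl = ⊥-elim (a∉ b∈)
  Reaches-fresh-prefix (c ∷ s) a∉ (vis-step st r) eq | inj₁ b∈ with eq zero
  ... | refl = vis-step st (Reaches-fresh-prefix s (λ a∈ → a∉ (acts-step st a∈)) r (λ i → eq (suc i)))

  ·ω-reflects-⊆ : Infinite Act → ∀ {v m n} → (Reaches v m ·ω) ⊆ (Reaches v n ·ω) → Reaches v m ⊆ Reaches v n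
  ·ω-reflects-⊆ inf {n = n} h {s} r with inf (acts n)
  ... | a , a∉ with h (s , const a , r , λ i → refl)
  ...   | t , u , r′ , eq = Reaches-fresh-prefix s a∉ r′ (λ i → sym (eq i))

  ·ω-reflects-≐ : Infinite Act → ∀ {v m n} → (Lang v m ·ω) ≐ (Lang v n ·ω) → Lang v m ≐ Lang v n
  ·ω-reflects-≐ inf {v} {m} {n} e = begin
    Lang v m    ≈⟨ Lang≐Reaches ⟩
    Reaches v m ≈⟨ ⊆-antisym (·ω-reflects-⊆ inf (≐⇒⊆ eR)) (·ω-reflects-⊆ inf (≐⇒⊆ (≐-sym eR))) ⟩
    Reaches v n ≈⟨ Lang≐Reaches ⟨
    Lang v n    ∎
    where
    open SetoidReasoning (≐-setoid (List Act))
    eR : (Reaches v m ·ω) ≐ (Reaches v n ·ω)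
    eR = ≐-trans (·ω-resp-≐ (≐-sym Lang≐Reaches)) (≐-trans e (·ω-resp-≐ Lang≐Reaches))

  ≃ωc⇒≃c : Infinite Act → ∀ {m n : Mon Act} → m ≃ωc n → m ≃c n
  ≃ωc⇒≃c inf (eₐ , eᵣ) = ·ω-reflects-≐ inf eₐ , ·ω-reflects-≐ inf eᵣ

  anyThenYes : List Act → Mon Act
  anyThenYes []       = verd end
  anyThenYes (a ∷ as) = act a (verd yes) ⊕ anyThenYes as

  anyThenYes-closed : ∀ as → Closed (anyThenYes as)
  anyThenYes-closed []       = c-verd
  anyThenYes-closed (a ∷ as) = c-sum (c-act c-verd) (anyThenYes-closed as)

  anyThenYes-accepts : ∀ {a as} → a ∈ as → Reaches yes (anyThenYes as) (a ∷ [])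
  anyThenYes-accepts (here refl) = proj₂ (Reaches-⊕ _) (inj₁ (proj₂ (Reaches-act _) (_ , refl , stop)))
  anyThenYes-accepts (there a∈)  = proj₂ (Reaches-⊕ _) (inj₂ (anyThenYes-accepts a∈))

  anyThenYes-¬accepts-[] : ∀ as → ¬ Reaches yes (anyThenYes as) []
  anyThenYes-¬accepts-[] [] r with Reaches-verd r
  ... | ()
  anyThenYes-¬accepts-[] (a ∷ as) r with proj₁ (Reaches-⊕ []) r
  ... | inj₁ r′ with proj₁ (Reaches-act []) r′
  ...   | _ , () , _
  anyThenYes-¬accepts-[] (a ∷ as) r | inj₂ r′ = anyThenYes-¬accepts-[] as r′

  anyThenYes-¬rejects : ∀ as {s} → ¬ Reaches no (anyThenYes as) s
  anyThenYes-¬rejects [] r with Reaches-verd r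
  ... | ()
  anyThenYes-¬rejects (a ∷ as) {s} r with proj₁ (Reaches-⊕ s) r
  ... | inj₁ r′ with proj₁ (Reaches-act s) r′
  ...   | _ , refl , r″ with Reaches-verd r″
  ...     | ()
  anyThenYes-¬rejects (a ∷ as) r | inj₂ r′ = anyThenYes-¬rejects as r′

  Instances : Rel (Mon Act) 0ℓ → Rel (Mon Act) 0ℓ
  Instances R m n = ∀ σ → ClosedSubst σ → R (subst σ m) (subst σ n)

  Instances-isCongruence : ∀ {R} → IsCongruence R → IsCongruence (Instances R)
  Instances-isCongruence isCong = record
    { isEquivalence = record
      { refl  = λ σ c → R.refl
      ; sym   = λ h σ c → R.sym (h σ c)
      ; trans = λ h k σ c → R.trans (h σ c) (k σ c)
      }
    ; pres-act = λ a h σ c → R.pres-act a (h σ c)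
    ; pres-sum = λ h k σ c → R.pres-sum (h σ c) (k σ c)
    }
    where module R where
            open IsCongruence isCong public
            open IsEquivalence isEquivalence public

  Instances-mono : ∀ {R S : Rel (Mon Act) 0ℓ} → (∀ {m n} → R m n → S m n)
                 → ∀ m n → Instances R m n → Instances S m n
  Instances-mono R⇒S m n h σ c = R⇒S {subst σ m} {subst σ n} (h σ c)

  subst-closed : ∀ {σ} {m : Mon Act} → Closed m → subst σ m ≡ m
  subst-closed c-verd      = refl
  subst-closed (c-act c)   = cong (act _) (subst-closed c)
  subst-closed (c-sum c d) = cong₂ _⊕_ (subst-closed c) (subst-closed d)

  module _ {R : Rel (Mon Act) 0ℓ} {m n : Mon Act} (cm : Closed m) (cn : Closed n) where

    Instances-closed⁺ : R m n → Instances R m n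
    Instances-closed⁺ h σ c rewrite subst-closed {σ} cm | subst-closed {σ} cn = h

    Instances-closed⁻ : Instances R m n → R m n
    Instances-closed⁻ h with h (const (verd end)) (const c-verd)
    ... | h′ rewrite subst-closed {const (verd end)} cm | subst-closed {const (verd end)} cn = h′

  ≃⇒≃ω : ∀ (m n : Mon Act) → m ≃ n → m ≃ω n
  ≃⇒≃ω = Instances-mono {R = _≃c_} {S = _≃ωc_} ≃c⇒≃ωc

  ≃ω⇒≃ : Infinite Act → ∀ (m n : Mon Act) → m ≃ω n → m ≃ n
  ≃ω⇒≃ inf = Instances-mono {R = _≃ωc_} {S = _≃c_} (≃ωc⇒≃c inf)

  finite-separation : Finite Act → ∃₂ λ (m n : Mon Act) → m ≃ω n × ¬ (m ≃ n)
  finite-separation (as , all∈) =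
    verd yes , anyThenYes as ,
    Instances-closed⁺ {R = _≃ωc_} c-verd (anyThenYes-closed as) (accept-all , reject-none) ,
    λ h → anyThenYes-¬accepts-[] as
            (weak⇒Reaches (proj₁ (proj₁ (Instances-closed⁻ {R = _≃c_} c-verd (anyThenYes-closed as) h) []) (w-ε ε-refl)))
    where
    accept-all : (Lₐ (verd yes) ·ω) ≐ (Lₐ (anyThenYes as) ·ω)
    accept-all w = (λ _ → ·ω-full (λ a → Reaches⇒weak (anyThenYes-accepts (all∈ a))) w)
                 , (λ _ → ·ω-full (λ a → verd-weak (a ∷ [])) w)
    reject-none : (Lᵣ (verd yes) ·ω) ≐ (Lᵣ (anyThenYes as) ·ω)
    reject-none w = (λ (_ , _ , p , _) → ⊥-elim (yes≢no (Reaches-verd (weak⇒Reaches p))))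
                  , (λ (_ , _ , p , _) → ⊥-elim (anyThenYes-¬rejects as (weak⇒Reaches p)))
      where
      yes≢no : ¬ yes ≡ no
      yes≢no ()

lemma2 : {Act : Set} →
    -- (i)
    (IsCongruence (_≃_ {Act}) × IsCongruence (_≃ω_ {Act}))
    -- (ii)
    × ((∀ (m n : Mon Act) → m ≃ n → m ≃ω n)
       × (Finite Act → ∃₂ λ (m n : Mon Act) → m ≃ω n × ¬ (m ≃ n)))
    -- (iii)
    × (Infinite Act → ∀ (m n : Mon Act) → (m ≃ n → m ≃ω n) × (m ≃ω n → m ≃ n))
lemma2 =
    (Instances-isCongruence ≃c-isCongruence , Instances-isCongruence ≃ωc-isCongruence)
  , (≃⇒≃ω , finite-separation)
  , λ inf m n → ≃⇒≃ω m n , ≃ω⇒≃ inf m n
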